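{- Let $n\ge1$ and $\Sigma=\{0,1,2,3\}$. The number of unitrades in $\Sigma^n$ is $2^{3^n}$. In particular, the rank over $\mathrm{GF}(2)$ of the matrix $A$ (defined in the context) is $4^n-3^n$.
   Context: A line in $\Sigma^n$ is a set of $4$ words agreeing in all coordinates but one. A set $S\subseteq\Sigma^n$ is a unitrade if every line contains an even number of elements of $S$. Index the coordinates of vectors of length $4^n$ by the elements of $\Sigma^n$ in lexicographic order. Over $\mathrm{GF}(2)$ define the $n4^{n-1}\times4^n$ matrix $A$ by stacking the blocks $A_1,\dots,A_n$ vertically, where $A_i=I_{4^{i-1}}\otimes(1,1,1,1)\otimes I_{4^{n-i}}$, $\otimes$ denotes the Kronecker product and $I_m$ is the $m\times m$ identity matrix. (For $P\subseteq\Sigma^n$, with $X_P$ its characteristic column vector, $P$ is a unitrade iff $AX_P=0$.) -}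

module Defs where

open import Data.Bool using (Bool; true; false; _∧_; _xor_; if_then_else_)
open import Data.Sum using (inj₁; inj₂)
open import Data.Nat using (ℕ; zero; suc; _+_; _*_; _∸_; _^_; _≤_; _<_; pred)
open import Data.Nat.Properties using (*-comm; *-identityʳ; ^-distribˡ-+-*; m+[n∸m]≡n)
open import Data.Nat.Divisibility using (_∣_; _∣?_)
open import Data.Fin using (Fin; zero; suc; toℕ; cast; remQuot; combine; _≟_; splitAt)
open import Data.Fin.Properties using (all?; toℕ<n)
open import Data.Vec using (Vec; []; _∷_; lookup; _[_]≔_)
open import Data.List using (List; []; _∷_; _++_; map; allFin; filter; length)
open import Data.Nat.ListAction using (sum)
open import Data.Product using (Σ; ∃; _×_; _,_)
open import Relation.Nullary using (Dec; yes; no; ¬_)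
open import Relation.Nullary.Decidable using (⌊_⌋)
open import Relation.Binary.PropositionalEquality using (_≡_; refl; sym; trans; cong)

Σ₄ : Set
Σ₄ = Fin 4

Word : ℕ → Set
Word n = Vec Σ₄ n

lineCount : ∀ {n} → (Word n → Bool) → Fin n → Word n → ℕ
lineCount S i w = sum (map (λ a → if S (w [ i ]≔ a) then 1 else 0) (allFin 4))

IsUnitrade : ∀ {n} → (Word n → Bool) → Set
IsUnitrade {n} S = (i : Fin n) (w : Word n) → 2 ∣ lineCount S i w

-- lexicographic index of a word in Σ^n (first coordinate most significant)
index : ∀ {n} → Word n → Fin (4 ^ n)
index []      = zero
index (a ∷ w) = combine a (index w)

setOf : ∀ {n} → Vec Bool (4 ^ n) → Word n → Bool
setOf X w = lookup X (index w)

allWords? : ∀ n {P : Word n → Set} → ((w : Word n) → Dec (P w)) → Dec ((w : Word n) → P w)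
allWords? zero    P? with P? []
... | yes p = yes λ { [] → p }
... | no ¬p = no λ f → ¬p (f [])
allWords? (suc n) {P} P? with all? (λ a → allWords? n (λ w → P? (a ∷ w)))
... | yes p = yes λ { (a ∷ w) → p a w }
... | no ¬p = no λ f → ¬p (λ a w → f (a ∷ w))

isUnitrade? : ∀ {n} (S : Word n → Bool) → Dec (IsUnitrade S)
isUnitrade? {n} S = all? (λ i → allWords? n (λ w → 2 ∣? lineCount S i w))

allBoolVecs : (m : ℕ) → List (Vec Bool m)
allBoolVecs zero    = [] ∷ []
allBoolVecs (suc m) = map (true ∷_) (allBoolVecs m) ++ map (false ∷_) (allBoolVecs m)

numUnitrades : ℕ → ℕ
numUnitrades n = length (filter (λ X → isUnitrade? (setOf {n} X)) (allBoolVecs (4 ^ n)))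

-- Matrices over GF(2) (GF(2) = Bool with xor/∧)

Mat : ℕ → ℕ → Set
Mat m k = Fin m → Fin k → Bool

I : ∀ m → Mat m m
I m i j = ⌊ i ≟ j ⌋

ones : Mat 1 4
ones _ _ = true

-- Kronecker product: row (i,k) ↦ combine i k, column (j,l) ↦ combine j l
_⊗_ : ∀ {m k p q} → Mat m k → Mat p q → Mat (m * p) (k * q)
_⊗_ {p = p} {q = q} M N r c with remQuot p r | remQuot q c
... | (i , k) | (j , l) = M i j ∧ N k l

castMat : ∀ {m k m' k'} → m ≡ m' → k ≡ k' → Mat m k → Mat m' k'
castMat e₁ e₂ M r c = M (cast (sym e₁) r) (cast (sym e₂) c)

vstack : ∀ {m m' k} → Mat m k → Mat m' k → Mat (m + m') k
vstack {m} M N r c with splitAt m r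
... | inj₁ r' = M r' c
... | inj₂ r' = N r' c

stackN : ∀ t {m k} → (Fin t → Mat m k) → Mat (t * m) k
stackN zero    B ()
stackN (suc t) B = vstack (B zero) (stackN t (λ j → B (suc j)))

pred≡∸1 : ∀ n → pred n ≡ n ∸ 1
pred≡∸1 zero    = refl
pred≡∸1 (suc n) = refl

rowEq : ∀ n i → suc i ≤ n → 4 ^ i * 1 * 4 ^ (n ∸ suc i) ≡ 4 ^ (n ∸ 1)
rowEq n i p = trans (cong (_* 4 ^ (n ∸ suc i)) (*-identityʳ (4 ^ i)))
  (trans (sym (^-distribˡ-+-* 4 i (n ∸ suc i)))
         (cong (4 ^_) (trans (cong pred (m+[n∸m]≡n p)) (pred≡∸1 n))))

colEq : ∀ n i → suc i ≤ n → 4 ^ i * 4 * 4 ^ (n ∸ suc i) ≡ 4 ^ n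
colEq n i p = trans (cong (_* 4 ^ (n ∸ suc i)) (*-comm (4 ^ i) 4))
  (trans (sym (^-distribˡ-+-* 4 (suc i) (n ∸ suc i))) (cong (4 ^_) (m+[n∸m]≡n p)))

-- A_i = I_{4^{i-1}} ⊗ (1,1,1,1) ⊗ I_{4^{n-i}}  (here i is 0-based: toℕ i = i-1)
block : ∀ n → (i : Fin n) → Mat (4 ^ (n ∸ 1)) (4 ^ n)
block n i = castMat (rowEq n (toℕ i) (toℕ<n i)) (colEq n (toℕ i) (toℕ<n i))
  ((I (4 ^ toℕ i) ⊗ ones) ⊗ I (4 ^ (n ∸ suc (toℕ i))))

A : ∀ n → Mat (n * 4 ^ (n ∸ 1)) (4 ^ n)
A n = stackN n (block n)

lincomb : ∀ {r k} → (Fin r → Bool) → (Fin r → Fin k → Bool) → Fin k → Bool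
lincomb {zero}  c v x = false
lincomb {suc r} c v x = (c zero ∧ v zero x) xor lincomb (λ j → c (suc j)) (λ j → v (suc j)) x

LinIndep : ∀ {r k} → (Fin r → Fin k → Bool) → Set
LinIndep v = ∀ c → (∀ x → lincomb c v x ≡ false) → ∀ j → c j ≡ false

HasRank : ∀ {m k} → Mat m k → ℕ → Set
HasRank {m} M r =
  (Σ (Fin r → Fin m) λ f → LinIndep (λ j → M (f j)))
  × ((f : Fin (suc r) → Fin m) → ¬ LinIndep (λ j → M (f j)))

module Submission where

-- A unitrade is determined by its values on the 3 ^ n words without the letter 0, and every assignment
-- of values there extends: the value at a word whose first letter is 0 is forced by the line through it
-- in that direction.
--
-- The rows of A are the indicators of lines, so every row is orthogonal to every unitrade. For each of the
-- 4 ^ n - 3 ^ n words w containing a 0, take the line through w in the direction of its first 0; ordered by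
-- the position of that first 0 these rows are triangular, hence independent. Conversely, a combination of
-- rows vanishing on the words containing a 0 must vanish everywhere: pairing it with the unitrade generated
-- by a single zero-free word picks out its value there.

open import Defs
open import Algebra.Bundles using (CommutativeRing)
open import Data.Bool using (Bool; true; false; _∧_; _xor_; not; if_then_else_)
open import Data.Bool.Properties
  using (xor-∧-commutativeRing; xor-same; xor-identityʳ; ∧-zeroʳ; ∧-identityʳ; ∧-assoc; ∧-distribʳ-xor;
         not-involutive)
import Data.Bool.Properties as Bool
open import Data.Empty using (⊥-elim)
open import Data.Fin as Fin
  using (Fin; zero; suc; toℕ; cast; splitAt; join; _↑ˡ_; _↑ʳ_; punchIn; combine; remQuot; funToFin; finToFun)
open import Data.Fin.Properties
  using (punchInᵢ≢i; funToFin-finToFin; finToFun-funToFin; combine-injective; combine-remQuot; remQuot-combine;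
         toℕ-combine; toℕ-cast; toℕ-injective; toℕ<n; cast-involutive; splitAt-↑ˡ; splitAt-↑ʳ; splitAt-join;
         join-splitAt; suc-injective; 0≢1+n; pigeonhole)
open import Data.List as List using (List; []; _∷_; _++_)
open import Data.List.Properties using (map-cong; map-++; map-∘; length-++; length-map)
open import Data.Nat using (ℕ; zero; suc; _+_; _*_; _^_; _∸_; _≤_; _<_; s≤s; z≤n)
open import Data.Nat.Divisibility using (_∣_; divides; ∣-refl; ∣m∣n⇒∣m+n)
import Data.Nat.ListAction as ℕ
open import Data.Nat.ListAction.Properties using (sum-++)
open import Data.Nat.Properties
  using (+-commutativeSemigroup; +-identityʳ; ≤-refl; ≤-pred; <-≤-trans; <-irrefl; n<1+n; ^-monoʳ-<; +-∸-assoc;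
         *-distribˡ-∸; *-monoʳ-≤; ^-monoˡ-≤)
open import Data.Nat.Tactic.RingSolver using (solve-∀)
open import Data.Product using (Σ; ∃; _×_; _,_; proj₁; proj₂; uncurry)
open import Data.Sum using (_⊎_; inj₁; inj₂)
open import Data.Vec as Vec using (Vec; []; _∷_; _[_]≔_; lookup; tabulate)
import Data.Vec.Properties as Vec
open import Function using (_∘_; _⇔_; mk⇔; Equivalence)
open import Relation.Binary.Definitions using (DecidableEquality)
open import Relation.Binary.PropositionalEquality
  using (_≡_; _≢_; refl; sym; trans; cong; cong₂; subst; _≗_; module ≡-Reasoning)
open import Relation.Nullary using (¬_; yes; no; does)
open import Relation.Nullary.Decidable using (_×-dec_; isYes≗does; does-⇔; dec-true; dec-false)
open import Relation.Unary using (Decidable)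

open import Algebra.Properties.CommutativeSemigroup +-commutativeSemigroup using (interchange)
open CommutativeRing xor-∧-commutativeRing using (semiring)
open import Algebra.Properties.Semiring.Sum semiring
  using (sum; sum-cong-≗; sum-remove; sum-replicate-zero; ∑-distrib-+; ∑-comm)

private variable
  X Y : Set

xor≡false⇒≡ : ∀ x y → x xor y ≡ false → x ≡ y
xor≡false⇒≡ false false _ = refl
xor≡false⇒≡ true  true  _ = refl

sum-zero : ∀ {k} (f : Fin k → Bool) → (∀ a → f a ≡ false) → sum f ≡ false
sum-zero {k} f f≡0 = trans (sum-cong-≗ f≡0) (sum-replicate-zero k)

sum-delta : ∀ {k} (f : Fin k → Bool) b → (∀ a → a ≢ b → f a ≡ false) → sum f ≡ f b
sum-delta {suc k} f b f≡0 = trans (sum-remove {i = b} f)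
  (trans (cong (f b xor_) (sum-zero _ (λ a → f≡0 (punchIn b a) (punchInᵢ≢i b a))))
         (xor-identityʳ (f b)))

wordSum : ∀ {k} n → (Vec (Fin k) n → Bool) → Bool
wordSum zero    f = f []
wordSum (suc n) f = sum (λ a → wordSum n (λ w → f (a ∷ w)))

wordSum-cong : ∀ {k} n {f g : Vec (Fin k) n → Bool} → f ≗ g → wordSum n f ≡ wordSum n g
wordSum-cong zero    f≗g = f≗g []
wordSum-cong (suc n) f≗g = sum-cong-≗ (λ a → wordSum-cong n (λ w → f≗g (a ∷ w)))

wordSum-zero : ∀ {k} n (f : Vec (Fin k) n → Bool) → (∀ x → f x ≡ false) → wordSum n f ≡ false
wordSum-zero zero    f f≡0 = f≡0 []
wordSum-zero (suc n) f f≡0 = sum-zero _ (λ a → wordSum-zero n _ (λ w → f≡0 (a ∷ w)))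

wordSum-delta : ∀ {k} n (f : Vec (Fin k) n → Bool) z → (∀ x → x ≢ z → f x ≡ false) → wordSum n f ≡ f z
wordSum-delta zero    f []      _   = refl
wordSum-delta (suc n) f (b ∷ z) f≡0 =
  trans (sum-delta _ b (λ a a≢b → wordSum-zero n _ (λ w → f≡0 (a ∷ w) (a≢b ∘ cong Vec.head))))
        (wordSum-delta n _ z (λ w w≢z → f≡0 (b ∷ w) (w≢z ∘ cong Vec.tail)))

wordSum-distrib-xor : ∀ {k} n (f g : Vec (Fin k) n → Bool) →
  wordSum n (λ x → f x xor g x) ≡ wordSum n f xor wordSum n g
wordSum-distrib-xor zero    f g = refl
wordSum-distrib-xor (suc n) f g =
  trans (sum-cong-≗ (λ a → wordSum-distrib-xor n (λ w → f (a ∷ w)) (λ w → g (a ∷ w))))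
        (∑-distrib-+ (λ a → wordSum n (λ w → f (a ∷ w))) (λ a → wordSum n (λ w → g (a ∷ w))))

wordSum-distribˡ-∧ : ∀ {k} n c (f : Vec (Fin k) n → Bool) → wordSum n (λ x → c ∧ f x) ≡ c ∧ wordSum n f
wordSum-distribˡ-∧ n true  f = refl
wordSum-distribˡ-∧ n false f = wordSum-zero n _ (λ _ → refl)

⟨_,_⟩ : ∀ {k n} → (Vec (Fin k) n → Bool) → (Vec (Fin k) n → Bool) → Bool
⟨ f , g ⟩ = wordSum _ (λ x → f x ∧ g x)

_⊥_ : ∀ {k n} → (Vec (Fin k) n → Bool) → (Vec (Fin k) n → Bool) → Set
f ⊥ g = ⟨ f , g ⟩ ≡ false

𝟙 : Bool → ℕ
𝟙 b = if b then 1 else 0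

isOdd : ℕ → Bool
isOdd zero    = false
isOdd (suc m) = not (isOdd m)

even⇔isOdd≡false : ∀ m → 2 ∣ m ⇔ isOdd m ≡ false
even⇔isOdd≡false m = mk⇔ even⇒ (isOdd≡false⇒even m)
  where
  isOdd-double : ∀ q → isOdd (q * 2) ≡ false
  isOdd-double zero    = refl
  isOdd-double (suc q) = trans (not-involutive _) (isOdd-double q)
  even⇒ : ∀ {m} → 2 ∣ m → isOdd m ≡ false
  even⇒ (divides q refl) = isOdd-double q
  isOdd≡false⇒even : ∀ m → isOdd m ≡ false → 2 ∣ m
  isOdd≡false⇒even zero          _ = divides 0 refl
  isOdd≡false⇒even (suc (suc m)) p =
    ∣m∣n⇒∣m+n ∣-refl (isOdd≡false⇒even m (trans (sym (not-involutive _)) p))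

isOdd-count : ∀ {k} (f : Fin k → Bool) → isOdd (ℕ.sum (List.tabulate (𝟙 ∘ f))) ≡ sum f
isOdd-count {zero}  f = refl
isOdd-count {suc k} f with f zero
... | true  = cong not (isOdd-count (f ∘ suc))
... | false = isOdd-count (f ∘ suc)

LineSumsVanish : ∀ {k n} → (Vec (Fin k) n → Bool) → Set
LineSumsVanish {n = n} S = ∀ (i : Fin n) w → sum (λ a → S (w [ i ]≔ a)) ≡ false

lineSumsVanish-resp-≗ : ∀ {k n} {S T : Vec (Fin k) n → Bool} → S ≗ T → LineSumsVanish S → LineSumsVanish T
lineSumsVanish-resp-≗ S≗T v i w = trans (sum-cong-≗ (λ a → sym (S≗T (w [ i ]≔ a)))) (v i w)

-- lineCount unfolds definitionally to the count in isOdd-count, since allFin 4 is a closed list.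
isUnitrade⇔lineSumsVanish : ∀ {n} (S : Word n → Bool) → IsUnitrade S ⇔ LineSumsVanish S
isUnitrade⇔lineSumsVanish S = mk⇔
  (λ u i w → trans (sym (isOdd-count (line i w))) (Equivalence.to (even⇔isOdd≡false _) (u i w)))
  (λ v i w → Equivalence.from (even⇔isOdd≡false _) (trans (isOdd-count (line i w)) (v i w)))
  where
  line : ∀ i w → Fin 4 → Bool
  line i w a = S (w [ i ]≔ a)

extend : ∀ {k n} → (Vec (Fin k) n → Bool) → Vec (Fin (suc k)) n → Bool
extend g []          = g []
extend g (zero  ∷ w) = sum (λ c → extend (λ u → g (c ∷ u)) w)
extend g (suc c ∷ w) = extend (λ u → g (c ∷ u)) w

extend-lineSumsVanish : ∀ {k n} (g : Vec (Fin k) n → Bool) → LineSumsVanish (extend g)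
extend-lineSumsVanish g zero    (_ ∷ w)     = xor-same (extend g (zero ∷ w))
extend-lineSumsVanish g (suc i) (zero ∷ w)  =
  trans (∑-comm (λ a c → extend (λ u → g (c ∷ u)) (w [ i ]≔ a)))
        (sum-zero _ (λ c → extend-lineSumsVanish (λ u → g (c ∷ u)) i w))
extend-lineSumsVanish g (suc i) (suc c ∷ w) = extend-lineSumsVanish _ i w

extend-map-suc : ∀ {k n} (g : Vec (Fin k) n → Bool) u → extend g (Vec.map suc u) ≡ g u
extend-map-suc g []      = refl
extend-map-suc g (c ∷ u) = extend-map-suc _ u

extend-cong : ∀ {k n} {g h : Vec (Fin k) n → Bool} → g ≗ h → extend g ≗ extend h
extend-cong g≗h []          = g≗h []
extend-cong g≗h (zero  ∷ w) = sum-cong-≗ (λ c → extend-cong (λ u → g≗h (c ∷ u)) w)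
extend-cong g≗h (suc c ∷ w) = extend-cong (λ u → g≗h (c ∷ u)) w

lineSumsVanish⇒≗extend : ∀ {k n} (S : Vec (Fin (suc k)) n → Bool) → LineSumsVanish S →
  S ≗ extend (S ∘ Vec.map suc)
lineSumsVanish⇒≗extend S _ [] = refl
lineSumsVanish⇒≗extend S v (zero ∷ w) =
  trans (xor≡false⇒≡ (S (zero ∷ w)) _ (v zero (zero ∷ w)))
        (sum-cong-≗ (λ c → lineSumsVanish⇒≗extend _ (λ i x → v (suc i) (suc c ∷ x)) w))
lineSumsVanish⇒≗extend S v (suc c ∷ w) =
  lineSumsVanish⇒≗extend _ (λ i x → v (suc i) (suc c ∷ x)) w

∑ : List X → (X → ℕ) → ℕ
∑ xs f = ℕ.sum (List.map f xs)

∑-cong : ∀ (xs : List X) {f g : X → ℕ} → f ≗ g → ∑ xs f ≡ ∑ xs g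
∑-cong xs f≗g = cong ℕ.sum (map-cong f≗g xs)

∑-++ : ∀ (xs ys : List X) f → ∑ (xs ++ ys) f ≡ ∑ xs f + ∑ ys f
∑-++ xs ys f = trans (cong ℕ.sum (map-++ f xs ys)) (sum-++ (List.map f xs) (List.map f ys))

∑-map : ∀ (g : X → Y) xs f → ∑ (List.map g xs) f ≡ ∑ xs (f ∘ g)
∑-map g xs f = cong ℕ.sum (sym (map-∘ xs))

∑-zero : ∀ (xs : List X) → ∑ xs (λ _ → 0) ≡ 0
∑-zero []       = refl
∑-zero (x ∷ xs) = ∑-zero xs

∑-one≡length : ∀ (xs : List X) → ∑ xs (λ _ → 1) ≡ List.length xs
∑-one≡length []       = refl
∑-one≡length (x ∷ xs) = cong suc (∑-one≡length xs)

∑-+ : ∀ (xs : List X) f g → ∑ xs (λ x → f x + g x) ≡ ∑ xs f + ∑ xs g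
∑-+ []       f g = refl
∑-+ (x ∷ xs) f g =
  trans (cong (f x + g x +_) (∑-+ xs f g)) (interchange (f x) (g x) (∑ xs f) (∑ xs g))

∑-swap : ∀ (f : X → Y → ℕ) xs ys → ∑ xs (λ x → ∑ ys (f x)) ≡ ∑ ys (λ y → ∑ xs (λ x → f x y))
∑-swap f []       ys = sym (∑-zero ys)
∑-swap f (x ∷ xs) ys = trans (cong (∑ ys (f x) +_) (∑-swap f xs ys)) (sym (∑-+ ys (f x) _))

length-filter : ∀ {P : X → Set} (P? : Decidable P) xs →
  List.length (List.filter P? xs) ≡ ∑ xs (𝟙 ∘ does ∘ P?)
length-filter P? []       = refl
length-filter P? (x ∷ xs) with does (P? x)
... | true  = cong suc (length-filter P? xs)
... | false = length-filter P? xs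

record Enumerates (_≟_ : DecidableEquality X) (xs : List X) : Set where
  field
    multiplicity≡1 : ∀ a → ∑ xs (λ x → 𝟙 (does (a ≟ x))) ≡ 1
open Enumerates

length-filter-section : ∀ {_≟X_ : DecidableEquality X} {_≟Y_ : DecidableEquality Y} {xs ys} →
  Enumerates _≟X_ xs → Enumerates _≟Y_ ys →
  {P : X → Set} (P? : Decidable P) (enc : X → Y) (dec : Y → X) →
  (∀ y → P (dec y)) → (∀ y → enc (dec y) ≡ y) → (∀ x → P x → dec (enc x) ≡ x) →
  List.length (List.filter P? xs) ≡ List.length ys
length-filter-section {_≟X_ = _≟X_} {_≟Y_} {xs} {ys} enumXs enumYs {P} P? enc dec P-dec enc-dec dec-enc = begin
  List.length (List.filter P? xs)                    ≡⟨ length-filter P? xs ⟩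
  ∑ xs (𝟙 ∘ does ∘ P?)                               ≡⟨ ∑-cong xs fibre ⟩
  ∑ xs (λ x → ∑ ys (λ y → 𝟙 (does (dec y ≟X x))))   ≡⟨ ∑-swap _ xs ys ⟩
  ∑ ys (λ y → ∑ xs (λ x → 𝟙 (does (dec y ≟X x))))   ≡⟨ ∑-cong ys (multiplicity≡1 enumXs ∘ dec) ⟩
  ∑ ys (λ _ → 1)                                     ≡⟨ ∑-one≡length ys ⟩
  List.length ys                                     ∎
  where
  open ≡-Reasoning
  fibre : ∀ x → 𝟙 (does (P? x)) ≡ ∑ ys (λ y → 𝟙 (does (dec y ≟X x)))
  fibre x with P? x
  ... | yes Px = sym (trans (∑-cong ys (λ y → cong 𝟙 (does-⇔ (dec≡⇔enc≡ y) (dec y ≟X x) (enc x ≟Y y))))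
                            (multiplicity≡1 enumYs (enc x)))
    where
    dec≡⇔enc≡ : ∀ y → dec y ≡ x ⇔ enc x ≡ y
    dec≡⇔enc≡ y = mk⇔ (λ e → trans (cong enc (sym e)) (enc-dec y))
                      (λ e → trans (cong dec (sym e)) (dec-enc x Px))
  ... | no ¬Px = sym (trans (∑-cong ys (λ y → cong 𝟙 (dec-false (dec y ≟X x) (¬Px ∘ λ e → subst P e (P-dec y)))))
                            (∑-zero ys))

allBoolVecs-enumerates : ∀ m → Enumerates (Vec.≡-dec Bool._≟_) (allBoolVecs m)
multiplicity≡1 (allBoolVecs-enumerates zero)    [] = refl
multiplicity≡1 (allBoolVecs-enumerates (suc m)) (b ∷ v) =
  trans (∑-++ (List.map (true ∷_) vs) _ _)
        (trans (cong₂ _+_ (∑-map (true ∷_) vs _) (∑-map (false ∷_) vs _)) (by-head b))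
  where
  vs = allBoolVecs m
  by-head : ∀ b → ∑ vs (λ x → 𝟙 (does (Vec.≡-dec Bool._≟_ (b ∷ v) (true ∷ x))))
                + ∑ vs (λ x → 𝟙 (does (Vec.≡-dec Bool._≟_ (b ∷ v) (false ∷ x)))) ≡ 1
  by-head true  = cong₂ _+_ (multiplicity≡1 (allBoolVecs-enumerates m) v) (∑-zero vs)
  by-head false = cong₂ _+_ (∑-zero vs) (multiplicity≡1 (allBoolVecs-enumerates m) v)

length-allBoolVecs : ∀ m → List.length (allBoolVecs m) ≡ 2 ^ m
length-allBoolVecs zero    = refl
length-allBoolVecs (suc m) =
  trans (length-++ (List.map (true ∷_) vs))
        (cong₂ _+_ (trans (length-map _ vs) (length-allBoolVecs m))
                   (trans (length-map _ vs) (trans (length-allBoolVecs m) (sym (+-identityʳ _)))))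
  where vs = allBoolVecs m

funToFin-cong : ∀ {m n} {f g : Fin m → Fin n} → f ≗ g → funToFin f ≡ funToFin g
funToFin-cong {zero}  f≗g = refl
funToFin-cong {suc m} f≗g = cong₂ combine (f≗g zero) (funToFin-cong (f≗g ∘ suc))

toIndex : ∀ {k n} → Vec (Fin k) n → Fin (k ^ n)
toIndex w = funToFin (lookup w)

fromIndex : ∀ {k} n → Fin (k ^ n) → Vec (Fin k) n
fromIndex n t = tabulate (finToFun t)

toIndex-fromIndex : ∀ {k} n (t : Fin (k ^ n)) → toIndex (fromIndex n t) ≡ t
toIndex-fromIndex {k} n t =
  trans (funToFin-cong {n} {k} (Vec.lookup∘tabulate (finToFun t))) (funToFin-finToFin {n} {k} t)

fromIndex-toIndex : ∀ {k n} (w : Vec (Fin k) n) → fromIndex n (toIndex w) ≡ w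
fromIndex-toIndex w = trans (Vec.tabulate-cong (finToFun-funToFin (lookup w))) (Vec.tabulate∘lookup w)

index≡toIndex : ∀ {n} (w : Word n) → index w ≡ toIndex w
index≡toIndex []      = refl
index≡toIndex (a ∷ w) = cong (combine a) (index≡toIndex w)

index-fromIndex : ∀ n (t : Fin (4 ^ n)) → index (fromIndex n t) ≡ t
index-fromIndex n t = trans (index≡toIndex (fromIndex n t)) (toIndex-fromIndex n t)

index-injective : ∀ {n} {w y : Word n} → index w ≡ index y → w ≡ y
index-injective {n} {w} {y} e = begin
  w                        ≡⟨ fromIndex-toIndex w ⟨
  fromIndex n (toIndex w)  ≡⟨ cong (fromIndex n) (trans (sym (index≡toIndex w)) (trans e (index≡toIndex y))) ⟩
  fromIndex n (toIndex y)  ≡⟨ fromIndex-toIndex y ⟩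
  y                        ∎
  where open ≡-Reasoning

toTable : ∀ {k n} → (Vec (Fin k) n → Bool) → Vec Bool (k ^ n)
toTable {n = n} g = tabulate (g ∘ fromIndex n)

fromTable : ∀ {k n} → Vec Bool (k ^ n) → Vec (Fin k) n → Bool
fromTable y = lookup y ∘ toIndex

fromTable-toTable : ∀ {k n} (g : Vec (Fin k) n → Bool) → fromTable (toTable g) ≗ g
fromTable-toTable g w = trans (Vec.lookup∘tabulate _ (toIndex w)) (cong g (fromIndex-toIndex w))

toTable-fromTable : ∀ {k n} (y : Vec Bool (k ^ n)) → toTable (fromTable {k} {n} y) ≡ y
toTable-fromTable {n = n} y =
  trans (Vec.tabulate-cong (cong (lookup y) ∘ toIndex-fromIndex n)) (Vec.tabulate∘lookup y)

toTable-cong : ∀ {k n} {g h : Vec (Fin k) n → Bool} → g ≗ h → toTable g ≡ toTable h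
toTable-cong g≗h = Vec.tabulate-cong (g≗h ∘ fromIndex _)

setOf≗fromTable : ∀ {n} (X : Vec Bool (4 ^ n)) → setOf X ≗ fromTable {4} {n} X
setOf≗fromTable X = cong (lookup X) ∘ index≡toIndex

numUnitrades≡2^3^n : ∀ n → numUnitrades n ≡ 2 ^ (3 ^ n)
numUnitrades≡2^3^n n =
  trans (length-filter-section (allBoolVecs-enumerates (4 ^ n)) (allBoolVecs-enumerates (3 ^ n))
           (λ X → isUnitrade? (setOf {n} X)) restrict extend′
           extend′-isUnitrade restrict-extend′ extend′-restrict)
        (length-allBoolVecs (3 ^ n))
  where
  S : Vec Bool (4 ^ n) → Word n → Bool
  S = setOf
  g : Vec Bool (3 ^ n) → Vec (Fin 3) n → Bool
  g = fromTable
  restrict : Vec Bool (4 ^ n) → Vec Bool (3 ^ n)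
  restrict X = toTable (S X ∘ Vec.map suc)
  extend′ : Vec Bool (3 ^ n) → Vec Bool (4 ^ n)
  extend′ y = toTable (extend (g y))
  S-extend′ : ∀ y → S (extend′ y) ≗ extend (g y)
  S-extend′ y w = trans (setOf≗fromTable {n} (extend′ y) w) (fromTable-toTable (extend (g y)) w)
  extend′-isUnitrade : ∀ y → IsUnitrade (S (extend′ y))
  extend′-isUnitrade y = Equivalence.from (isUnitrade⇔lineSumsVanish (S (extend′ y)))
    (lineSumsVanish-resp-≗ (sym ∘ S-extend′ y) (extend-lineSumsVanish (g y)))
  restrict-extend′ : ∀ y → restrict (extend′ y) ≡ y
  restrict-extend′ y = begin
    toTable (S (extend′ y) ∘ Vec.map suc)
      ≡⟨ toTable-cong (λ u → trans (S-extend′ y (Vec.map suc u)) (extend-map-suc (g y) u)) ⟩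
    toTable (g y)                          ≡⟨ toTable-fromTable {3} {n} y ⟩
    y                                      ∎
    where open ≡-Reasoning
  extend′-restrict : ∀ X → IsUnitrade (S X) → extend′ (restrict X) ≡ X
  extend′-restrict X u = begin
    toTable (extend (g (restrict X)))      ≡⟨ toTable-cong (extend-cong (fromTable-toTable (S X ∘ Vec.map suc))) ⟩
    toTable (extend (S X ∘ Vec.map suc))   ≡⟨ toTable-cong (lineSumsVanish⇒≗extend (S X) lsv) ⟨
    toTable (S X)                          ≡⟨ toTable-cong (setOf≗fromTable {n} X) ⟩
    toTable (fromTable {4} {n} X)          ≡⟨ toTable-fromTable {4} {n} X ⟩
    X                                      ∎
    where
    open ≡-Reasoning
    lsv = Equivalence.to (isUnitrade⇔lineSumsVanish (S X)) u

onLine : ∀ {k n} → Fin n → Vec (Fin k) n → Vec (Fin k) n → Bool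
onLine zero    (_ ∷ w) (_ ∷ y) = does (Vec.≡-dec Fin._≟_ w y)
onLine (suc i) (b ∷ w) (a ∷ y) = does (b Fin.≟ a) ∧ onLine i w y

onLine-refl : ∀ {k n} (i : Fin n) (w : Vec (Fin k) n) → onLine i w w ≡ true
onLine-refl zero    (_ ∷ w) = dec-true (Vec.≡-dec Fin._≟_ w w) refl
onLine-refl (suc i) (b ∷ w) = cong₂ _∧_ (dec-true (b Fin.≟ b) refl) (onLine-refl i w)

⟨onLine,⟩≡lineSum : ∀ {k n} (i : Fin n) (w : Vec (Fin k) n) u →
  ⟨ onLine i w , u ⟩ ≡ sum (λ a → u (w [ i ]≔ a))
⟨onLine,⟩≡lineSum {n = suc n} zero (_ ∷ w) u = sum-cong-≗ λ a →
  trans (wordSum-delta n _ w (λ x x≢w → cong (_∧ u (a ∷ x))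
                                               (dec-false (Vec.≡-dec Fin._≟_ w x) (x≢w ∘ sym))))
        (cong (_∧ u (a ∷ w)) (dec-true (Vec.≡-dec Fin._≟_ w w) refl))
⟨onLine,⟩≡lineSum {n = suc n} (suc i) (b ∷ w) u =
  trans (sum-delta _ b (λ a a≢b → wordSum-zero n _ (λ x → cong (λ d → (d ∧ onLine i w x) ∧ u (a ∷ x))
                                                                (dec-false (b Fin.≟ a) (a≢b ∘ sym)))))
        (trans (wordSum-cong n (λ x → cong (λ d → (d ∧ onLine i w x) ∧ u (b ∷ x)) (dec-true (b Fin.≟ b) refl)))
               (⟨onLine,⟩≡lineSum i w (λ x → u (b ∷ x))))

prefixIndex : ∀ {n} (i : Fin n) → Word n → Fin (4 ^ toℕ i)
prefixIndex zero    _       = zero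
prefixIndex (suc i) (a ∷ w) = combine a (prefixIndex i w)

suffixIndex : ∀ {n} (i : Fin n) → Word n → Fin (4 ^ (n ∸ suc (toℕ i)))
suffixIndex zero    (_ ∷ w) = index w
suffixIndex (suc i) (_ ∷ w) = suffixIndex i w

onLine≡sameAffixes : ∀ {n} (i : Fin n) (w y : Word n) →
  onLine i w y ≡ does (prefixIndex i w Fin.≟ prefixIndex i y) ∧ does (suffixIndex i w Fin.≟ suffixIndex i y)
onLine≡sameAffixes zero    (_ ∷ w) (_ ∷ y) =
  does-⇔ (mk⇔ (cong index) index-injective) (Vec.≡-dec Fin._≟_ w y) (index w Fin.≟ index y)
onLine≡sameAffixes (suc i) (b ∷ w) (a ∷ y) = begin
  does (b Fin.≟ a) ∧ onLine i w y
    ≡⟨ cong (does (b Fin.≟ a) ∧_) (onLine≡sameAffixes i w y) ⟩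
  does (b Fin.≟ a) ∧ (does (prefixIndex i w Fin.≟ prefixIndex i y) ∧ _)
    ≡⟨ ∧-assoc (does (b Fin.≟ a)) _ _ ⟨
  (does (b Fin.≟ a) ∧ does (prefixIndex i w Fin.≟ prefixIndex i y)) ∧ _
    ≡⟨ cong (_∧ _) (does-⇔ (mk⇔ (uncurry (cong₂ combine)) (combine-injective b _ a _))
                           ((b Fin.≟ a) ×-dec (prefixIndex i w Fin.≟ prefixIndex i y))
                           (combine b (prefixIndex i w) Fin.≟ combine a (prefixIndex i y))) ⟩
  does (combine b (prefixIndex i w) Fin.≟ combine a (prefixIndex i y)) ∧ _
    ∎
  where open ≡-Reasoning

affixes-surjective : ∀ {n} (i : Fin n) p q → ∃ λ (w : Word n) → prefixIndex i w ≡ p × suffixIndex i w ≡ q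
affixes-surjective {suc n} zero    zero q = zero ∷ fromIndex n q , refl , index-fromIndex n q
affixes-surjective {suc n} (suc i) p q with remQuot (4 ^ toℕ i) p in eq
... | a , p′ with affixes-surjective i p′ q
...   | w , pre , suf =
  a ∷ w ,
  trans (cong (combine a) pre) (trans (cong (uncurry combine) (sym eq)) (combine-remQuot {4} (4 ^ toℕ i) p)) ,
  suf

index-split : ∀ {n} (i : Fin n) (y : Word n) → toℕ (index y) ≡
  4 ^ (n ∸ suc (toℕ i)) * (4 * toℕ (prefixIndex i y) + toℕ (lookup y i)) + toℕ (suffixIndex i y)
index-split {suc n} zero    (a ∷ y) = toℕ-combine a (index y)
index-split {suc n} (suc i) (a ∷ y) = begin
  toℕ (combine a (index y))
    ≡⟨ toℕ-combine a (index y) ⟩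
  4 ^ n * toℕ a + toℕ (index y)
    ≡⟨ cong₂ (λ m s → m * toℕ a + s) (sym (colEq n (toℕ i) (toℕ<n i))) (index-split i y) ⟩
  4 ^ toℕ i * 4 * Q * toℕ a + (Q * (4 * toℕ (prefixIndex i y) + toℕ (lookup y i)) + toℕ (suffixIndex i y))
    ≡⟨ shift (4 ^ toℕ i) Q (toℕ a) (toℕ (prefixIndex i y)) (toℕ (lookup y i)) (toℕ (suffixIndex i y)) ⟩
  Q * (4 * (4 ^ toℕ i * toℕ a + toℕ (prefixIndex i y)) + toℕ (lookup y i)) + toℕ (suffixIndex i y)
    ≡⟨ cong (λ m → Q * (4 * m + toℕ (lookup y i)) + toℕ (suffixIndex i y)) (toℕ-combine a (prefixIndex i y)) ⟨
  Q * (4 * toℕ (combine a (prefixIndex i y)) + toℕ (lookup y i)) + toℕ (suffixIndex i y)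
    ∎
  where
  open ≡-Reasoning
  Q = 4 ^ (n ∸ suc (toℕ i))
  shift : ∀ R Q a p b s → R * 4 * Q * a + (Q * (4 * p + b) + s) ≡ Q * (4 * (R * a + p) + b) + s
  shift = solve-∀

cast-index : ∀ {n} (i : Fin n) (y : Word n) →
  cast (sym (colEq n (toℕ i) (toℕ<n i))) (index y) ≡ combine (combine (prefixIndex i y) (lookup y i)) (suffixIndex i y)
cast-index {n} i y = toℕ-injective (begin
  toℕ (cast _ (index y))
    ≡⟨ toℕ-cast _ (index y) ⟩
  toℕ (index y)
    ≡⟨ index-split i y ⟩
  4 ^ (n ∸ suc (toℕ i)) * (4 * toℕ (prefixIndex i y) + toℕ (lookup y i)) + toℕ (suffixIndex i y)
    ≡⟨ cong (λ m → 4 ^ (n ∸ suc (toℕ i)) * m + toℕ (suffixIndex i y))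
            (toℕ-combine (prefixIndex i y) (lookup y i)) ⟨
  4 ^ (n ∸ suc (toℕ i)) * toℕ (combine (prefixIndex i y) (lookup y i)) + toℕ (suffixIndex i y)
    ≡⟨ toℕ-combine (combine (prefixIndex i y) (lookup y i)) (suffixIndex i y) ⟨
  toℕ (combine (combine (prefixIndex i y) (lookup y i)) (suffixIndex i y))
    ∎)
  where open ≡-Reasoning

⊗-combine : ∀ {m k p q} (M : Mat m k) (N : Mat p q) i j r c →
  (M ⊗ N) (combine i r) (combine j c) ≡ (M i j ∧ N r c)
⊗-combine {p = p} {q} M N i j r c = cong₂ (λ x y → M (proj₁ x) (proj₁ y) ∧ N (proj₂ x) (proj₂ y))
                                          (remQuot-combine {k = p} i r) (remQuot-combine {k = q} j c)

-- The middle factor (1,1,1,1) of A_i has a single row, so the rows of A_i are indexed by pairs (p, q).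
blockRow : ∀ n (i : Fin n) → Fin (4 ^ toℕ i) → Fin (4 ^ (n ∸ suc (toℕ i))) → Fin (4 ^ (n ∸ 1))
blockRow n i p q = cast (rowEq n (toℕ i) (toℕ<n i)) (combine (combine p zero) q)

block-blockRow : ∀ n (i : Fin n) p q (y : Word n) →
  block n i (blockRow n i p q) (index y) ≡ does (p Fin.≟ prefixIndex i y) ∧ does (q Fin.≟ suffixIndex i y)
block-blockRow n i p q y = begin
  M (cast _ (blockRow n i p q)) (cast _ (index y))
    ≡⟨ cong₂ M (cast-involutive (sym e) e (combine (combine p zero) q)) (cast-index i y) ⟩
  M (combine (combine p zero) q) (combine (combine (prefixIndex i y) (lookup y i)) (suffixIndex i y))
    ≡⟨ ⊗-combine (I _ ⊗ ones) (I _) _ _ q (suffixIndex i y) ⟩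
  (I _ ⊗ ones) (combine p zero) (combine (prefixIndex i y) (lookup y i)) ∧ I _ q (suffixIndex i y)
    ≡⟨ cong (_∧ I _ q (suffixIndex i y)) (⊗-combine (I _) ones p (prefixIndex i y) zero (lookup y i)) ⟩
  (I _ p (prefixIndex i y) ∧ true) ∧ I _ q (suffixIndex i y)
    ≡⟨ cong₂ _∧_ (trans (∧-identityʳ _) (isYes≗does (p Fin.≟ prefixIndex i y)))
                 (isYes≗does (q Fin.≟ suffixIndex i y)) ⟩
  does (p Fin.≟ prefixIndex i y) ∧ does (q Fin.≟ suffixIndex i y)
    ∎
  where
  open ≡-Reasoning
  e = rowEq n (toℕ i) (toℕ<n i)
  M = (I (4 ^ toℕ i) ⊗ ones) ⊗ I (4 ^ (n ∸ suc (toℕ i)))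

blockRow-surjective : ∀ n (i : Fin n) ρ → ∃ λ p → ∃ λ q → blockRow n i p q ≡ ρ
blockRow-surjective n i ρ with remQuot (4 ^ (n ∸ suc (toℕ i))) (cast (sym (rowEq n (toℕ i) (toℕ<n i))) ρ) in eq₁
... | pz , q with remQuot {4 ^ toℕ i} 1 pz in eq₂
...   | p , zero = p , q , (begin
  cast e (combine (combine p zero) q)
    ≡⟨ cong (λ x → cast e (combine x q))
            (trans (cong (uncurry combine) (sym eq₂)) (combine-remQuot {4 ^ toℕ i} 1 pz)) ⟩
  cast e (combine pz q)
    ≡⟨ cong (cast e)
            (trans (cong (uncurry combine) (sym eq₁)) (combine-remQuot {4 ^ toℕ i * 1} _ (cast (sym e) ρ))) ⟩
  cast e (cast (sym e) ρ)
    ≡⟨ cast-involutive e (sym e) ρ ⟩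
  ρ ∎)
  where
  open ≡-Reasoning
  e = rowEq n (toℕ i) (toℕ<n i)

blockRow-onLine : ∀ n (i : Fin n) w y →
  block n i (blockRow n i (prefixIndex i w) (suffixIndex i w)) (index y) ≡ onLine i w y
blockRow-onLine n i w y = trans (block-blockRow n i _ _ y) (sym (onLine≡sameAffixes i w y))

block-row-onLine : ∀ n (i : Fin n) ρ → ∃ λ w → ∀ y → block n i ρ (index y) ≡ onLine i w y
block-row-onLine n i ρ = w , λ y → trans (cong (λ ρ → block n i ρ (index y)) (sym ρ≡)) (blockRow-onLine n i w y)
  where
  pq = blockRow-surjective n i ρ
  affixes = affixes-surjective i (proj₁ pq) (proj₁ (proj₂ pq))
  w = proj₁ affixes
  ρ≡ : blockRow n i (prefixIndex i w) (suffixIndex i w) ≡ ρ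
  ρ≡ = trans (cong₂ (blockRow n i) (proj₁ (proj₂ affixes)) (proj₂ (proj₂ affixes))) (proj₂ (proj₂ pq))

stackN-row : ∀ t {m k} (B : Fin t → Mat m k) ρ → ∃ λ i → ∃ λ ρ′ → stackN t B ρ ≗ B i ρ′
stackN-row (suc t) {m} B ρ with splitAt m ρ
... | inj₁ ρ′ = zero , ρ′ , λ _ → refl
... | inj₂ ρ′ with stackN-row t (B ∘ suc) ρ′
...   | i , ρ″ , eq = suc i , ρ″ , eq

stackN-row⁻¹ : ∀ t {m k} (B : Fin t → Mat m k) i ρ′ → ∃ λ ρ → stackN t B ρ ≗ B i ρ′
stackN-row⁻¹ (suc t) {m} B zero ρ′ = ρ′ ↑ˡ (t * m) , row
  where
  row : stackN (suc t) B (ρ′ ↑ˡ (t * m)) ≗ B zero ρ′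
  row c rewrite splitAt-↑ˡ m ρ′ (t * m) = refl
stackN-row⁻¹ (suc t) {m} B (suc i) ρ′ with stackN-row⁻¹ t (B ∘ suc) i ρ′
... | ρ , eq = m ↑ʳ ρ , row
  where
  row : stackN (suc t) B (m ↑ʳ ρ) ≗ B (suc i) ρ′
  row c rewrite splitAt-↑ʳ m (t * m) ρ = eq c

A-row-onLine : ∀ n ρ → ∃ λ i → ∃ λ w → ∀ y → A n ρ (index y) ≡ onLine i w y
A-row-onLine n ρ = i , proj₁ line , λ y → trans (proj₂ (proj₂ row) (index y)) (proj₂ line y)
  where
  row = stackN-row n (block n) ρ
  i = proj₁ row
  line = block-row-onLine n i (proj₁ (proj₂ row))

onLine-A-row : ∀ n i w → ∃ λ ρ → ∀ y → A n ρ (index y) ≡ onLine i w y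
onLine-A-row n i w = proj₁ row , λ y → trans (proj₂ row (index y)) (blockRow-onLine n i w y)
  where row = stackN-row⁻¹ n (block n) i (blockRow n i (prefixIndex i w) (suffixIndex i w))

hasZero : ∀ {k n} → Vec (Fin (suc k)) n → Bool
hasZero []          = false
hasZero (zero  ∷ _) = true
hasZero (suc _ ∷ w) = hasZero w

hasZero≡false⇒map-suc : ∀ {k n} (y : Vec (Fin (suc k)) n) → hasZero y ≡ false → ∃ λ z → Vec.map suc z ≡ y
hasZero≡false⇒map-suc []          _ = [] , refl
hasZero≡false⇒map-suc (suc c ∷ y) h with hasZero≡false⇒map-suc y h
... | z , refl = c ∷ z , refl

firstZero : ∀ {k n} → Vec (Fin (suc k)) (suc n) → Fin (suc n)
firstZero (zero ∷ _)              = zero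
firstZero {n = zero}  (suc _ ∷ _) = zero
firstZero {n = suc n} (suc _ ∷ w) = suc (firstZero w)

firstZero<firstZero : ∀ {k n} (q p : Vec (Fin (suc k)) (suc n)) → hasZero q ≡ true → hasZero p ≡ true →
  onLine (firstZero q) q p ≡ true → p ≢ q → toℕ (firstZero q) < toℕ (firstZero p)
firstZero<firstZero (zero ∷ q) (zero ∷ p) _ _ on p≢q with Vec.≡-dec Fin._≟_ q p | on
... | yes refl | _  = ⊥-elim (p≢q refl)
... | no _     | ()
firstZero<firstZero {n = zero}  (zero ∷ q) (suc a ∷ []) _ () _ _
firstZero<firstZero {n = suc n} (zero ∷ q) (suc a ∷ p)  _ _ _ _ = s≤s z≤n
firstZero<firstZero {n = zero}  (suc c ∷ []) _ () _ _ _
firstZero<firstZero {n = suc n} (suc c ∷ q) (zero ∷ p) _ _ () _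
firstZero<firstZero {n = suc n} (suc c ∷ q) (suc a ∷ p) hq hp on p≢q with c Fin.≟ a | on
... | yes refl | on′ = s≤s (firstZero<firstZero q p hq hp on′ (p≢q ∘ cong (suc c ∷_)))
... | no _     | ()

-- A word with a zero starts with 0, or with one of the 3 other letters followed by a word with a zero.
4^∸3^-suc : ∀ n → 4 ^ suc n ∸ 3 ^ suc n ≡ 4 ^ n + 3 * (4 ^ n ∸ 3 ^ n)
4^∸3^-suc n = trans (+-∸-assoc (4 ^ n) (*-monoʳ-≤ 3 (^-monoˡ-≤ n (s≤s (s≤s (s≤s z≤n))))))
                    (cong (4 ^ n +_) (sym (*-distribˡ-∸ 3 (4 ^ n) (3 ^ n))))

withZero : ∀ n → Fin (4 ^ n ∸ 3 ^ n) → Word n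
withZero-step : ∀ n → Fin (4 ^ n) ⊎ Fin (3 * (4 ^ n ∸ 3 ^ n)) → Word (suc n)
withZero (suc n) t = withZero-step n (splitAt (4 ^ n) (cast (4^∸3^-suc n) t))
withZero-step n (inj₁ s) = zero ∷ fromIndex n s
withZero-step n (inj₂ s) = suc (proj₁ (remQuot {3} (4 ^ n ∸ 3 ^ n) s))
                         ∷ withZero n (proj₂ (remQuot {3} (4 ^ n ∸ 3 ^ n) s))

withZero-hasZero : ∀ n t → hasZero (withZero n t) ≡ true
withZero-step-hasZero : ∀ n x → hasZero (withZero-step n x) ≡ true
withZero-hasZero (suc n) t = withZero-step-hasZero n (splitAt (4 ^ n) (cast (4^∸3^-suc n) t))
withZero-step-hasZero n (inj₁ s) = refl
withZero-step-hasZero n (inj₂ s) = withZero-hasZero n (proj₂ (remQuot {3} (4 ^ n ∸ 3 ^ n) s))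

withZero-injective : ∀ n {t t′} → withZero n t ≡ withZero n t′ → t ≡ t′
withZero-step-injective : ∀ n {x x′} → withZero-step n x ≡ withZero-step n x′ → x ≡ x′
withZero-injective (suc n) {t} {t′} e = begin
  t                                    ≡⟨ cast-involutive (sym eq) eq t ⟨
  cast (sym eq) (cast eq t)            ≡⟨ cong (cast (sym eq)) (join-splitAt (4 ^ n) m (cast eq t)) ⟨
  cast (sym eq) (join-split (cast eq t))  ≡⟨ cong (cast (sym eq) ∘ join (4 ^ n) m) (withZero-step-injective n e) ⟩
  cast (sym eq) (join-split (cast eq t′)) ≡⟨ cong (cast (sym eq)) (join-splitAt (4 ^ n) m (cast eq t′)) ⟩
  cast (sym eq) (cast eq t′)           ≡⟨ cast-involutive (sym eq) eq t′ ⟩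
  t′                                   ∎
  where
  open ≡-Reasoning
  eq = 4^∸3^-suc n
  m = 3 * (4 ^ n ∸ 3 ^ n)
  join-split = join (4 ^ n) m ∘ splitAt (4 ^ n)
withZero-step-injective n {inj₁ s} {inj₁ s′} e =
  cong inj₁ (trans (sym (toIndex-fromIndex n s)) (trans (cong (toIndex ∘ Vec.tail) e) (toIndex-fromIndex n s′)))
withZero-step-injective n {inj₁ _} {inj₂ _} e = ⊥-elim (0≢1+n (cong Vec.head e))
withZero-step-injective n {inj₂ _} {inj₁ _} e = ⊥-elim (0≢1+n (sym (cong Vec.head e)))
withZero-step-injective n {inj₂ s} {inj₂ s′} e = cong inj₂ (begin
  s                                   ≡⟨ combine-remQuot {3} m s ⟨
  uncurry combine (remQuot {3} m s)
    ≡⟨ cong₂ combine (suc-injective (cong Vec.head e)) (withZero-injective n (cong Vec.tail e)) ⟩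
  uncurry combine (remQuot {3} m s′)  ≡⟨ combine-remQuot {3} m s′ ⟩
  s′                                  ∎)
  where
  open ≡-Reasoning
  m = 4 ^ n ∸ 3 ^ n

withZero-join : ∀ n x → withZero (suc n) (cast (sym (4^∸3^-suc n)) (join (4 ^ n) _ x)) ≡ withZero-step n x
withZero-join n x = cong (withZero-step n)
  (trans (cong (splitAt (4 ^ n)) (cast-involutive (4^∸3^-suc n) (sym (4^∸3^-suc n)) _)) (splitAt-join (4 ^ n) _ x))

withZero-surjective : ∀ n (y : Word n) → hasZero y ≡ true → ∃ λ t → withZero n t ≡ y
withZero-surjective (suc n) (zero ∷ y) _ =
  cast _ (join (4 ^ n) _ (inj₁ (toIndex y))) ,
  trans (withZero-join n (inj₁ (toIndex y))) (cong (zero ∷_) (fromIndex-toIndex y))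
withZero-surjective (suc n) (suc c ∷ y) h with withZero-surjective n y h
... | t , refl =
  cast _ (join (4 ^ n) _ (inj₂ (combine c t))) ,
  trans (withZero-join n (inj₂ (combine c t))) (cong (λ (c , t) → suc c ∷ withZero n t) (remQuot-combine c t))

lincomb≡sum : ∀ {r k} (c : Fin r → Bool) (v : Fin r → Fin k → Bool) x →
  lincomb c v x ≡ sum (λ j → c j ∧ v j x)
lincomb≡sum {zero}  c v x = refl
lincomb≡sum {suc r} c v x = cong ((c zero ∧ v zero x) xor_) (lincomb≡sum (c ∘ suc) (v ∘ suc) x)

lincomb-xor : ∀ {r k} (c d : Fin r → Bool) (v : Fin r → Fin k → Bool) x →
  lincomb (λ j → c j xor d j) v x ≡ lincomb c v x xor lincomb d v x
lincomb-xor c d v x = begin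
  lincomb (λ j → c j xor d j) v x
    ≡⟨ lincomb≡sum _ v x ⟩
  sum (λ j → (c j xor d j) ∧ v j x)
    ≡⟨ sum-cong-≗ (λ j → ∧-distribʳ-xor (v j x) (c j) (d j)) ⟩
  sum (λ j → (c j ∧ v j x) xor (d j ∧ v j x))
    ≡⟨ ∑-distrib-+ (λ j → c j ∧ v j x) (λ j → d j ∧ v j x) ⟩
  sum (λ j → c j ∧ v j x) xor sum (λ j → d j ∧ v j x)
    ≡⟨ cong₂ _xor_ (lincomb≡sum c v x) (lincomb≡sum d v x) ⟨
  lincomb c v x xor lincomb d v x
    ∎
  where open ≡-Reasoning

lincomb-⊥ : ∀ {r K k n} (c : Fin r → Bool) (v : Fin r → Fin K → Bool) (col : Vec (Fin k) n → Fin K) u →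
  (∀ j → (v j ∘ col) ⊥ u) → (lincomb c v ∘ col) ⊥ u
lincomb-⊥ {zero}  {n = n} c v col u _   = wordSum-zero n (λ y → false ∧ u y) (λ _ → refl)
lincomb-⊥ {suc r} {k = k} {n} c v col u v⊥u = begin
  wordSum n (λ y → ((c zero ∧ v zero (col y)) xor rest y) ∧ u y)
    ≡⟨ wordSum-cong n (λ y → trans (∧-distribʳ-xor (u y) (c zero ∧ v zero (col y)) (rest y))
                                   (cong (_xor (rest y ∧ u y)) (∧-assoc (c zero) (v zero (col y)) (u y)))) ⟩
  wordSum n (λ y → (c zero ∧ (v zero (col y) ∧ u y)) xor (rest y ∧ u y))
    ≡⟨ wordSum-distrib-xor n (λ y → c zero ∧ (v zero (col y) ∧ u y)) (λ y → rest y ∧ u y) ⟩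
  wordSum n (λ y → c zero ∧ (v zero (col y) ∧ u y)) xor ⟨ rest , u ⟩
    ≡⟨ cong₂ _xor_ (trans (wordSum-distribˡ-∧ n (c zero) (λ y → v zero (col y) ∧ u y))
                          (cong (c zero ∧_) (v⊥u zero)))
                   (lincomb-⊥ (c ∘ suc) (v ∘ suc) col u (v⊥u ∘ suc)) ⟩
  (c zero ∧ false) xor false
    ≡⟨ cong (_xor false) (∧-zeroʳ (c zero)) ⟩
  false
    ∎
  where
  open ≡-Reasoning
  rest : Vec (Fin k) n → Bool
  rest y = lincomb (c ∘ suc) (v ∘ suc) (col y)

triangular⇒linIndep : ∀ {r k} (v : Fin r → Fin k → Bool) (x : Fin r → Fin k) (h : Fin r → ℕ) →
  (∀ j → v j (x j) ≡ true) → (∀ j l → l ≢ j → v l (x j) ≡ true → h l < h j) → LinIndep v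
triangular⇒linIndep v x h diag below c c·v≡0 j = vanishes (suc (h j)) j ≤-refl
  where
  vanishes : ∀ K j → h j < K → c j ≡ false
  vanishes (suc K) j hj<K = begin
    c j                           ≡⟨ ∧-identityʳ (c j) ⟨
    c j ∧ true                    ≡⟨ cong (c j ∧_) (diag j) ⟨
    c j ∧ v j (x j)               ≡⟨ sum-delta (λ l → c l ∧ v l (x j)) j others ⟨
    sum (λ l → c l ∧ v l (x j))   ≡⟨ lincomb≡sum c v (x j) ⟨
    lincomb c v (x j)             ≡⟨ c·v≡0 (x j) ⟩
    false                         ∎
    where
    open ≡-Reasoning
    others : ∀ l → l ≢ j → c l ∧ v l (x j) ≡ false
    others l l≢j with v l (x j) in vl
    ... | false = ∧-zeroʳ (c l)
    ... | true  = cong (_∧ true) (vanishes K l (<-≤-trans (below j l l≢j vl) (≤-pred hj<K)))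

toBit : Bool → Fin 2
toBit false = zero
toBit true  = suc zero

fromBit : Fin 2 → Bool
fromBit zero    = false
fromBit (suc _) = true

toBit-injective : ∀ {a b} → toBit a ≡ toBit b → a ≡ b
toBit-injective {false} {false} _ = refl
toBit-injective {true}  {true}  _ = refl

fromBit-injective : ∀ {a b} → fromBit a ≡ fromBit b → a ≡ b
fromBit-injective {zero}     {zero}     _ = refl
fromBit-injective {suc zero} {suc zero} _ = refl

-- Pigeonhole: two of the 2 ^ (r + 1) coefficient vectors give the same combination, and their sum is nonzero.
dependent : ∀ {r} (v : Fin (suc r) → Fin r → Bool) →
  ∃ λ c → ¬ (∀ j → c j ≡ false) × (∀ t → lincomb c v t ≡ false)
dependent {r} v = c , c≢0 , c·v≡0
  where
  coeffs : Fin (2 ^ suc r) → Fin (suc r) → Bool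
  coeffs t = fromBit ∘ finToFun t
  image : Fin (2 ^ suc r) → Fin (2 ^ r)
  image t = funToFin (toBit ∘ lincomb (coeffs t) v)
  collision : ∃ λ i → ∃ λ j → i Fin.< j × image i ≡ image j
  collision = pigeonhole (^-monoʳ-< 2 (s≤s (s≤s z≤n)) (n<1+n r)) image
  i j : Fin (2 ^ suc r)
  i = proj₁ collision
  j = proj₁ (proj₂ collision)
  c : Fin (suc r) → Bool
  c l = coeffs i l xor coeffs j l
  c≢0 : ¬ (∀ l → c l ≡ false)
  c≢0 c≡0 = <-irrefl (cong toℕ i≡j) (proj₁ (proj₂ (proj₂ collision)))
    where
    i≡j : i ≡ j
    i≡j = begin
      i                                  ≡⟨ funToFin-finToFin {suc r} {2} i ⟨
      funToFin (finToFun {2} {suc r} i)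
        ≡⟨ funToFin-cong {suc r} {2} (λ l → fromBit-injective (xor≡false⇒≡ (coeffs i l) (coeffs j l) (c≡0 l))) ⟩
      funToFin (finToFun {2} {suc r} j)  ≡⟨ funToFin-finToFin {suc r} {2} j ⟩
      j                                  ∎
      where open ≡-Reasoning
  c·v≡0 : ∀ t → lincomb c v t ≡ false
  c·v≡0 t = begin
    lincomb c v t                                      ≡⟨ lincomb-xor (coeffs i) (coeffs j) v t ⟩
    lincomb (coeffs i) v t xor lincomb (coeffs j) v t
      ≡⟨ cong (_xor lincomb (coeffs j) v t) (toBit-injective same-bit) ⟩
    lincomb (coeffs j) v t xor lincomb (coeffs j) v t  ≡⟨ xor-same (lincomb (coeffs j) v t) ⟩
    false                                              ∎
    where
    open ≡-Reasoning
    same-bit : toBit (lincomb (coeffs i) v t) ≡ toBit (lincomb (coeffs j) v t)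
    same-bit = begin
      toBit (lincomb (coeffs i) v t)  ≡⟨ finToFun-funToFin (toBit ∘ lincomb (coeffs i) v) t ⟨
      finToFun (image i) t            ≡⟨ cong (λ a → finToFun a t) (proj₂ (proj₂ (proj₂ collision))) ⟩
      finToFun (image j) t            ≡⟨ finToFun-funToFin (toBit ∘ lincomb (coeffs j) v) t ⟩
      toBit (lincomb (coeffs j) v t)  ∎

restrictionInjective⇒¬linIndep : ∀ {r k} (v : Fin (suc r) → Fin k → Bool) (x : Fin r → Fin k) →
  (∀ c → (∀ t → lincomb c v (x t) ≡ false) → ∀ y → lincomb c v y ≡ false) → ¬ LinIndep v
restrictionInjective⇒¬linIndep {r} v x injective indep = proj₁ (proj₂ dep) (indep c (injective c c·v≡0-on-x))
  where
  vₓ : Fin (suc r) → Fin r → Bool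
  vₓ j t = v j (x t)
  dep = dependent vₓ
  c = proj₁ dep
  c·v≡0-on-x : ∀ t → lincomb c v (x t) ≡ false
  c·v≡0-on-x t = trans (lincomb≡sum c v (x t)) (trans (sym (lincomb≡sum c vₓ t)) (proj₂ (proj₂ dep) t))

-- Pairing L with the unitrade extending the indicator of a single zero-free word y picks out L y.
⊥unitrades⇒≡false : ∀ {k n} (L : Vec (Fin (suc k)) n → Bool) →
  (∀ x → hasZero x ≡ true → L x ≡ false) → (∀ u → LineSumsVanish u → L ⊥ u) → ∀ y → L y ≡ false
⊥unitrades⇒≡false {n = n} L zeroOn L⊥ y with hasZero y in hy
... | true  = zeroOn y hy
... | false with hasZero≡false⇒map-suc y hy
...   | z , refl = begin
  L (Vec.map suc z)                       ≡⟨ ∧-identityʳ _ ⟨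
  L (Vec.map suc z) ∧ true
    ≡⟨ cong (L (Vec.map suc z) ∧_) (trans (extend-map-suc δ z) (dec-true (z ≟ z) refl)) ⟨
  L (Vec.map suc z) ∧ u (Vec.map suc z)   ≡⟨ wordSum-delta n (λ x → L x ∧ u x) (Vec.map suc z) others ⟨
  ⟨ L , u ⟩                               ≡⟨ L⊥ u (extend-lineSumsVanish δ) ⟩
  false                                   ∎
  where
  open ≡-Reasoning
  _≟_ = Vec.≡-dec Fin._≟_
  δ = λ z′ → does (z ≟ z′)
  u = extend δ
  others : ∀ x → x ≢ Vec.map suc z → L x ∧ u x ≡ false
  others x x≢z with hasZero x in hx
  ... | true  = cong (_∧ u x) (zeroOn x hx)
  ... | false with hasZero≡false⇒map-suc x hx
  ...   | x′ , refl = trans (cong (L (Vec.map suc x′) ∧_) (trans (extend-map-suc δ x′) δ≡false)) (∧-zeroʳ _)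
    where δ≡false = dec-false (z ≟ x′) (x≢z ∘ cong (Vec.map suc) ∘ sym)

A-linIndepRows : ∀ n →
  Σ (Fin (4 ^ suc n ∸ 3 ^ suc n) → Fin (suc n * 4 ^ n)) λ f → LinIndep (λ j → A (suc n) (f j))
A-linIndepRows n = f , triangular⇒linIndep (A (suc n) ∘ f) (index ∘ p) (toℕ ∘ firstZero ∘ p) diag below
  where
  p : Fin (4 ^ suc n ∸ 3 ^ suc n) → Word (suc n)
  p = withZero (suc n)
  row : ∀ t → ∃ λ ρ → ∀ y → A (suc n) ρ (index y) ≡ onLine (firstZero (p t)) (p t) y
  row t = onLine-A-row (suc n) (firstZero (p t)) (p t)
  f : Fin (4 ^ suc n ∸ 3 ^ suc n) → Fin (suc n * 4 ^ n)
  f t = proj₁ (row t)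
  diag : ∀ j → A (suc n) (f j) (index (p j)) ≡ true
  diag j = trans (proj₂ (row j) (p j)) (onLine-refl (firstZero (p j)) (p j))
  below : ∀ j l → l ≢ j → A (suc n) (f l) (index (p j)) ≡ true →
          toℕ (firstZero (p l)) < toℕ (firstZero (p j))
  below j l l≢j on = firstZero<firstZero (p l) (p j) (withZero-hasZero (suc n) l) (withZero-hasZero (suc n) j)
    (trans (sym (proj₂ (row l) (p j))) on) (l≢j ∘ withZero-injective (suc n) ∘ sym)

A-rows-dependent : ∀ n (g : Fin (suc (4 ^ suc n ∸ 3 ^ suc n)) → Fin (suc n * 4 ^ n)) →
  ¬ LinIndep (λ j → A (suc n) (g j))
A-rows-dependent n g = restrictionInjective⇒¬linIndep v (index ∘ withZero (suc n)) injective
  where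
  v : Fin (suc (4 ^ suc n ∸ 3 ^ suc n)) → Fin (4 ^ suc n) → Bool
  v = A (suc n) ∘ g
  row⊥unitrades : ∀ u → LineSumsVanish u → ∀ j → (v j ∘ index) ⊥ u
  row⊥unitrades u lsv j = trans (wordSum-cong (suc n) (λ y → cong (_∧ u y) (proj₂ (proj₂ line) y)))
                                (trans (⟨onLine,⟩≡lineSum i w u) (lsv i w))
    where
    line = A-row-onLine (suc n) (g j)
    i = proj₁ line
    w = proj₁ (proj₂ line)
  injective : ∀ c → (∀ t → lincomb c v (index (withZero (suc n) t)) ≡ false) → ∀ y → lincomb c v y ≡ false
  injective c onWithZero y = begin
    lincomb c v y                              ≡⟨ cong (lincomb c v) (index-fromIndex (suc n) y) ⟨
    lincomb c v (index (fromIndex (suc n) y))  ≡⟨ ⊥unitrades⇒≡false (lincomb c v ∘ index) zeroOn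
                                                     (λ u lsv → lincomb-⊥ c v index u (row⊥unitrades u lsv))
                                                     (fromIndex (suc n) y) ⟩
    false                                      ∎
    where
    open ≡-Reasoning
    zeroOn : ∀ x → hasZero x ≡ true → lincomb c v (index x) ≡ false
    zeroOn x hx = subst (λ x → lincomb c v (index x) ≡ false) (proj₂ t) (onWithZero (proj₁ t))
      where t = withZero-surjective (suc n) x hx

lemma3 : (n : ℕ) → 1 ≤ n →
    numUnitrades n ≡ 2 ^ (3 ^ n) × HasRank (A n) (4 ^ n ∸ 3 ^ n)
lemma3 (suc n) _ = numUnitrades≡2^3^n (suc n) , A-linIndepRows n , A-rows-dependent n
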